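{- Let $p$ be a prime, and let $r, s \in \{0, 1, \dots, p-1\}$. The congruence $\binom{pa+r}{pb+s} \equiv \binom{a}{b}\binom{r}{s} \pmod{p^2}$ holds for all integers $a \geq 0$ and $b \geq 0$ if and only if $s \leq r$ and \[ \binom{r}{s} \equiv (-1)^{r-s}\binom{p-1-s}{r-s} \equiv (-1)^s \binom{p-1-r+s}{s} \pmod{p^2}. \]
   Context: Binomial coefficients $\binom{n}{k}$ with $k > n \geq 0$ are $0$. -}

module Defs where

open import Data.Nat using (ℕ; zero; suc)
open import Data.Integer using (ℤ; +_; -_; _-_; _*_)
open import Data.Integer.Divisibility using (_∣_)

infix 4 _≡_[mod_]
_≡_[mod_] : ℤ → ℤ → ℕ → Set
x ≡ y [mod m ] = (+ m) ∣ (x - y)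

sign : ℕ → ℤ
sign zero = + 1
sign (suc k) = - sign k

module Submission where

-- Write r = s + t, p = s + t + m + 1.  Everything reduces to the expansions
-- (x + 1)⋯(x + n) = n! + x e(n) + x² g of rising factorials at multiples x of
-- p, fed into a linearisation lemma: if L (Z + p u) ≡ B (X Z + p v) (mod p²)
-- and p ∤ Z, then L ≡ B X (mod p²) iff p ∣ B (v - X u).
-- (1) An exact rising-factorial identity relating C(p(b + c) + s + t, p b + s)
--     to C(p(b + c), p b) ≡ C(b + c, b) turns the congruence at a = b + c into
--     p ∣ C(a, b) (b δ(s, t) + c δ(t, s)): it holds for all a, b iff p ∣ δ(s, t), δ(t, s).
-- (2) Reflection turns (-1)^t C(m + t, t) t! into a rising factorial at -p,
--     giving C(s + t, s) ≡ (-1)^t C(m + t, t) iff p ∣ δ(s, t); symmetrically for δ(t, s).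
-- (3) If s > r the instance a = 1, b = 0 fails, as p divides C(p + r, s) only once.

open import Defs
open import Data.Nat using (ℕ; _+_; _*_; _∸_; _^_; _≤_; _<_)
open import Data.Nat.Primality using (Prime)
open import Data.Nat.Combinatorics using (_C_)
open import Data.Integer using (+_) renaming (_*_ to _*ℤ_)
open import Data.Product using (_×_)
open import Function.Bundles using (_⇔_)

open import Data.Nat as ℕ using (zero; suc; _!; NonZero)
import Data.Nat.Properties as ℕ
import Data.Nat.Divisibility as ℕ
open import Data.Nat.Primality using (euclidsLemma; prime⇒nonZero; ¬prime[1])
open import Data.Nat.Combinatorics
  using (nCk≡n!/k![n-k]!; k![n∸k]!∣n!; nCk+nC[k+1]≡[n+1]C[k+1]; k>n⇒nCk≡0; nCn≡1; nC1≡n; nCk≡nC[n∸k])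
open import Data.Nat.DivMod using (_/_; m/n*n≡m)
import Data.Nat.Tactic.RingSolver as ℕ-Solver
open import Data.Integer as ℤ using (ℤ; -_; _-_) renaming (_+_ to _+ℤ_)
import Data.Integer.Properties as ℤ
open import Data.Integer.Divisibility.Signed
open import Data.Integer.Tactic.RingSolver using (solve-∀)
open import Data.Product using (Σ; _,_; proj₁; proj₂)
open import Data.Sum using (inj₁; inj₂)
open import Data.Empty using (⊥-elim)
open import Level using (0ℓ)
open import Relation.Nullary using (¬_; yes; no)
open import Relation.Binary.Bundles using (Setoid)
open import Relation.Binary.PropositionalEquality
open import Function.Bundles using (mk⇔; Equivalence)

-- Congruences modulo m (in the sense of Defs) are signed divisibilities;
-- the signed divisibility of the library carries the arithmetic lemmas.
≡[mod]⇒∣ : ∀ {m x y} → x ≡ y [mod m ] → + m ∣ x - y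
≡[mod]⇒∣ = ∣ᵤ⇒∣

∣⇒≡[mod] : ∀ {m x y} → + m ∣ x - y → x ≡ y [mod m ]
∣⇒≡[mod] = ∣⇒∣ᵤ

≡⇒≡[mod] : ∀ {m x y} → x ≡ y → x ≡ y [mod m ]
≡⇒≡[mod] {m} {x} refl = ∣⇒≡[mod] {x = x} {x} (subst (+ m ∣_) (sym (ℤ.+-inverseʳ x)) (divides (+ 0) refl))

≡[mod]-sym : ∀ {m x y} → x ≡ y [mod m ] → y ≡ x [mod m ]
≡[mod]-sym {m} {x} {y} x≡y = ∣⇒≡[mod] {x = y} {x} (subst (+ m ∣_) (flip x y) (∣m⇒∣-m (≡[mod]⇒∣ {x = x} {y} x≡y)))
  where
  flip : ∀ x y → - (x - y) ≡ y - x
  flip = solve-∀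

≡[mod]-trans : ∀ {m x y z} → x ≡ y [mod m ] → y ≡ z [mod m ] → x ≡ z [mod m ]
≡[mod]-trans {m} {x} {y} {z} x≡y y≡z =
  ∣⇒≡[mod] {x = x} {z} (subst (+ m ∣_) (telescope x y z) (∣m∣n⇒∣m+n (≡[mod]⇒∣ {x = x} {y} x≡y) (≡[mod]⇒∣ {x = y} {z} y≡z)))
  where
  telescope : ∀ x y z → (x - y) +ℤ (y - z) ≡ x - z
  telescope = solve-∀

+-cong[mod] : ∀ {m x x′ y y′} → x ≡ x′ [mod m ] → y ≡ y′ [mod m ] → x +ℤ y ≡ x′ +ℤ y′ [mod m ]
+-cong[mod] {m} {x} {x′} {y} {y′} x≡x′ y≡y′ =
  ∣⇒≡[mod] {x = x +ℤ y} {x′ +ℤ y′} (subst (+ m ∣_) (regroup x x′ y y′)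
    (∣m∣n⇒∣m+n (≡[mod]⇒∣ {x = x} {x′} x≡x′) (≡[mod]⇒∣ {x = y} {y′} y≡y′)))
  where
  regroup : ∀ x x′ y y′ → (x - x′) +ℤ (y - y′) ≡ (x +ℤ y) - (x′ +ℤ y′)
  regroup = solve-∀

*-cong[mod] : ∀ {m x x′ y y′} → x ≡ x′ [mod m ] → y ≡ y′ [mod m ] → x *ℤ y ≡ x′ *ℤ y′ [mod m ]
*-cong[mod] {m} {x} {x′} {y} {y′} x≡x′ y≡y′ =
  ∣⇒≡[mod] {x = x *ℤ y} {x′ *ℤ y′} (subst (+ m ∣_) (regroup x x′ y y′)
    (∣m∣n⇒∣m+n (∣n⇒∣m*n y (≡[mod]⇒∣ {x = x} {x′} x≡x′)) (∣n⇒∣m*n x′ (≡[mod]⇒∣ {x = y} {y′} y≡y′))))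
  where
  regroup : ∀ x x′ y y′ → y *ℤ (x - x′) +ℤ x′ *ℤ (y - y′) ≡ x *ℤ y - x′ *ℤ y′
  regroup = solve-∀

+-multiple[mod] : ∀ {m} x k → x +ℤ k *ℤ + m ≡ x [mod m ]
+-multiple[mod] {m} x k = ∣⇒≡[mod] {x = x +ℤ k *ℤ + m} {x} (subst (+ m ∣_) (sym (cancel x k (+ m))) (divides k refl))
  where
  cancel : ∀ x k m → x +ℤ k *ℤ m - x ≡ k *ℤ m
  cancel = solve-∀

square : ∀ m → + (m ^ 2) ≡ + m *ℤ + m
square m = trans (cong +_ (cong (m ℕ.*_) (ℕ.*-identityʳ m))) (ℤ.pos-* m m)

≡[mod]-setoid : ℕ → Setoid 0ℓ 0ℓ
≡[mod]-setoid m = record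
  { Carrier = ℤ
  ; _≈_ = λ x y → x ≡ y [mod m ]
  ; isEquivalence = record
    { refl = λ {x} → ≡⇒≡[mod] {x = x} refl
    ; sym = λ {x} {y} → ≡[mod]-sym {x = x} {y}
    ; trans = λ {x} {y} {z} → ≡[mod]-trans {x = x} {y} {z} } }

rising : ℤ → ℕ → ℤ
rising x zero    = + 1
rising x (suc n) = (x +ℤ + suc n) *ℤ rising x n

rising-+ : ∀ x m n → rising x (m + n) ≡ rising x m *ℤ rising (x +ℤ + m) n
rising-+ x m zero rewrite ℕ.+-identityʳ m = sym (ℤ.*-identityʳ (rising x m))
rising-+ x m (suc n) rewrite ℕ.+-suc m n = begin
  (x +ℤ + suc (m + n)) *ℤ rising x (m + n)
    ≡⟨ cong ((x +ℤ + suc (m + n)) *ℤ_) (rising-+ x m n) ⟩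
  (x +ℤ + suc (m + n)) *ℤ (rising x m *ℤ rising (x +ℤ + m) n)
    ≡⟨ cong (λ k → (x +ℤ (+ 1 +ℤ k)) *ℤ (rising x m *ℤ rising (x +ℤ + m) n)) (ℤ.pos-+ m n) ⟩
  (x +ℤ (+ 1 +ℤ (+ m +ℤ + n))) *ℤ (rising x m *ℤ rising (x +ℤ + m) n)
    ≡⟨ regroup x (+ m) (+ n) (rising x m) (rising (x +ℤ + m) n) ⟩
  rising x m *ℤ ((x +ℤ + m +ℤ (+ 1 +ℤ + n)) *ℤ rising (x +ℤ + m) n) ∎
  where
  open ≡-Reasoning
  regroup : ∀ x m n a b → (x +ℤ (+ 1 +ℤ (m +ℤ n))) *ℤ (a *ℤ b) ≡ a *ℤ ((x +ℤ m +ℤ (+ 1 +ℤ n)) *ℤ b)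
  regroup = solve-∀

factorial-rising : ∀ m n → + ((m + n) !) ≡ + (m !) *ℤ rising (+ m) n
factorial-rising m zero rewrite ℕ.+-identityʳ m = sym (ℤ.*-identityʳ (+ (m !)))
factorial-rising m (suc n) = begin
  + ((m + suc n) !)                         ≡⟨ cong (λ k → + (k !)) (ℕ.+-suc m n) ⟩
  + (suc (m + n) ℕ.* (m + n) !)            ≡⟨ ℤ.pos-* (suc (m + n)) ((m + n) !) ⟩
  + suc (m + n) *ℤ + ((m + n) !)           ≡⟨ cong₂ _*ℤ_ (cong +_ (sym (ℕ.+-suc m n))) (factorial-rising m n) ⟩
  + (m + suc n) *ℤ (+ (m !) *ℤ rising (+ m) n) ≡⟨ swap (+ (m + suc n)) (+ (m !)) (rising (+ m) n) ⟩
  + (m !) *ℤ (+ (m + suc n) *ℤ rising (+ m) n) ∎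
  where
  open ≡-Reasoning
  swap : ∀ a b c → a *ℤ (b *ℤ c) ≡ b *ℤ (a *ℤ c)
  swap = solve-∀

rising-reflect : ∀ x n → sign n *ℤ rising x n ≡ rising (- x - + suc n) n
rising-reflect x zero = refl
rising-reflect x (suc n) = begin
  - sign n *ℤ ((x +ℤ + suc n) *ℤ rising x n)        ≡⟨ swap (sign n) (x +ℤ + suc n) (rising x n) ⟩
  (- (x +ℤ + suc n)) *ℤ (sign n *ℤ rising x n)      ≡⟨ cong ((- (x +ℤ + suc n)) *ℤ_) (rising-reflect x n) ⟩
  (- (x +ℤ + suc n)) *ℤ rising (- x - + suc n) n    ≡⟨ cong₂ (λ a b → a *ℤ rising b n) (first x (+ n)) (shift x (+ n)) ⟩
  rising y 1 *ℤ rising (y +ℤ + 1) n                 ≡⟨ sym (rising-+ y 1 n) ⟩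
  rising y (suc n)                                  ∎
  where
  open ≡-Reasoning
  y : ℤ
  y = - x - + suc (suc n)
  swap : ∀ a b c → - a *ℤ (b *ℤ c) ≡ (- b) *ℤ (a *ℤ c)
  swap = solve-∀
  first : ∀ x n → - (x +ℤ (+ 1 +ℤ n)) ≡ ((- x - (+ 1 +ℤ (+ 1 +ℤ n))) +ℤ + 1) *ℤ + 1
  first = solve-∀
  shift : ∀ x n → - x - (+ 1 +ℤ n) ≡ (- x - (+ 1 +ℤ (+ 1 +ℤ n))) +ℤ + 1
  shift = solve-∀

-- The coefficient of x in the polynomial (x + 1)(x + 2) ⋯ (x + n).
linearCoeff : ℕ → ℕ
linearCoeff zero    = 0
linearCoeff (suc n) = suc n ℕ.* linearCoeff n + n !

rising-expansion : ∀ x n → Σ ℤ λ g → rising x n ≡ + (n !) +ℤ x *ℤ + linearCoeff n +ℤ x *ℤ x *ℤ g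
rising-expansion x zero = + 0 , expand x
  where
  expand : ∀ x → + 1 ≡ + 1 +ℤ x *ℤ + 0 +ℤ x *ℤ x *ℤ + 0
  expand = solve-∀
rising-expansion x (suc n) with rising-expansion x n
... | g , expansion = + c +ℤ g *ℤ (x +ℤ + suc n) , (begin
  (x +ℤ + suc n) *ℤ rising x n
    ≡⟨ cong ((x +ℤ + suc n) *ℤ_) expansion ⟩
  (x +ℤ (+ 1 +ℤ + n)) *ℤ (+ (n !) +ℤ x *ℤ + c +ℤ x *ℤ x *ℤ g)
    ≡⟨ expand x (+ n) (+ (n !)) (+ c) g ⟩
  (+ 1 +ℤ + n) *ℤ + (n !) +ℤ x *ℤ ((+ 1 +ℤ + n) *ℤ + c +ℤ + (n !)) +ℤ x *ℤ x *ℤ (+ c +ℤ g *ℤ (x +ℤ + suc n))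
    ≡⟨ cong₂ (λ a b → a +ℤ x *ℤ b +ℤ x *ℤ x *ℤ (+ c +ℤ g *ℤ (x +ℤ + suc n)))
             (sym (ℤ.pos-* (suc n) (n !)))
             (trans (cong (_+ℤ + (n !)) (sym (ℤ.pos-* (suc n) c))) (sym (ℤ.pos-+ (suc n ℕ.* c) (n !)))) ⟩
  + (suc n !) +ℤ x *ℤ + linearCoeff (suc n) +ℤ x *ℤ x *ℤ (+ c +ℤ g *ℤ (x +ℤ + suc n)) ∎)
  where
  open ≡-Reasoning
  c : ℕ
  c = linearCoeff n
  expand : ∀ x n f c g → (x +ℤ (+ 1 +ℤ n)) *ℤ (f +ℤ x *ℤ c +ℤ x *ℤ x *ℤ g)
         ≡ (+ 1 +ℤ n) *ℤ f +ℤ x *ℤ ((+ 1 +ℤ n) *ℤ c +ℤ f) +ℤ x *ℤ x *ℤ (c +ℤ g *ℤ (x +ℤ (+ 1 +ℤ n)))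
  expand = solve-∀

rising-mod-square : ∀ m y n → rising (+ m *ℤ y) n ≡ + (n !) +ℤ + m *ℤ (y *ℤ + linearCoeff n) [mod m ^ 2 ]
rising-mod-square m y n = begin
  rising (+ m *ℤ y) n                                        ≡⟨ proj₂ (rising-expansion (+ m *ℤ y) n) ⟩
  + (n !) +ℤ + m *ℤ y *ℤ c +ℤ + m *ℤ y *ℤ (+ m *ℤ y) *ℤ g    ≡⟨ regroup (+ m) y (+ (n !)) c g ⟩
  linear +ℤ y *ℤ y *ℤ g *ℤ (+ m *ℤ + m)                      ≡⟨ cong (λ k → linear +ℤ y *ℤ y *ℤ g *ℤ k) (sym (square m)) ⟩
  linear +ℤ y *ℤ y *ℤ g *ℤ + (m ^ 2)                         ≈⟨ +-multiple[mod] linear (y *ℤ y *ℤ g) ⟩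
  linear                                                     ∎
  where
  open import Relation.Binary.Reasoning.Setoid (≡[mod]-setoid (m ^ 2))
  c g linear : ℤ
  c = + linearCoeff n
  g = proj₁ (rising-expansion (+ m *ℤ y) n)
  linear = + (n !) +ℤ + m *ℤ (y *ℤ c)
  regroup : ∀ m y f c g → f +ℤ m *ℤ y *ℤ c +ℤ m *ℤ y *ℤ (m *ℤ y) *ℤ g
          ≡ f +ℤ m *ℤ (y *ℤ c) +ℤ y *ℤ y *ℤ g *ℤ (m *ℤ m)
  regroup = solve-∀

rising-mod : ∀ m n → rising (+ m) n ≡ + (n !) [mod m ]
rising-mod m n = begin
  rising (+ m) n                                   ≡⟨ proj₂ (rising-expansion (+ m) n) ⟩
  + (n !) +ℤ + m *ℤ c +ℤ + m *ℤ + m *ℤ g           ≡⟨ regroup (+ m) (+ (n !)) c g ⟩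
  + (n !) +ℤ (c +ℤ + m *ℤ g) *ℤ + m                ≈⟨ +-multiple[mod] (+ (n !)) (c +ℤ + m *ℤ g) ⟩
  + (n !)                                          ∎
  where
  open import Relation.Binary.Reasoning.Setoid (≡[mod]-setoid m)
  c g : ℤ
  c = + linearCoeff n
  g = proj₁ (rising-expansion (+ m) n)
  regroup : ∀ m f c g → f +ℤ m *ℤ c +ℤ m *ℤ m *ℤ g ≡ f +ℤ (c +ℤ m *ℤ g) *ℤ m
  regroup = solve-∀

rising-product-mod-square : ∀ m y z s t →
  rising (+ m *ℤ y) s *ℤ rising (+ m *ℤ z) t
    ≡ + (s !) *ℤ + (t !) +ℤ + m *ℤ (y *ℤ + linearCoeff s *ℤ + (t !) +ℤ z *ℤ + (s !) *ℤ + linearCoeff t) [mod m ^ 2 ]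
rising-product-mod-square m y z s t = begin
  rising (+ m *ℤ y) s *ℤ rising (+ m *ℤ z) t
    ≈⟨ *-cong[mod] {x = rising (+ m *ℤ y) s} {S +ℤ + m *ℤ (y *ℤ Es)} {rising (+ m *ℤ z) t} {T +ℤ + m *ℤ (z *ℤ Et)}
                   (rising-mod-square m y s) (rising-mod-square m z t) ⟩
  (S +ℤ + m *ℤ (y *ℤ Es)) *ℤ (T +ℤ + m *ℤ (z *ℤ Et))
    ≡⟨ expand (+ m) y z S T Es Et ⟩
  S *ℤ T +ℤ + m *ℤ (y *ℤ Es *ℤ T +ℤ z *ℤ S *ℤ Et) +ℤ y *ℤ Es *ℤ (z *ℤ Et) *ℤ (+ m *ℤ + m)
    ≡⟨ cong (λ k → S *ℤ T +ℤ + m *ℤ (y *ℤ Es *ℤ T +ℤ z *ℤ S *ℤ Et) +ℤ y *ℤ Es *ℤ (z *ℤ Et) *ℤ k) (sym (square m)) ⟩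
  S *ℤ T +ℤ + m *ℤ (y *ℤ Es *ℤ T +ℤ z *ℤ S *ℤ Et) +ℤ y *ℤ Es *ℤ (z *ℤ Et) *ℤ + (m ^ 2)
    ≈⟨ +-multiple[mod] (S *ℤ T +ℤ + m *ℤ (y *ℤ Es *ℤ T +ℤ z *ℤ S *ℤ Et)) (y *ℤ Es *ℤ (z *ℤ Et)) ⟩
  S *ℤ T +ℤ + m *ℤ (y *ℤ Es *ℤ T +ℤ z *ℤ S *ℤ Et) ∎
  where
  open import Relation.Binary.Reasoning.Setoid (≡[mod]-setoid (m ^ 2))
  S T Es Et : ℤ
  S = + (s !)
  T = + (t !)
  Es = + linearCoeff s
  Et = + linearCoeff t
  expand : ∀ m y z S T Es Et → (S +ℤ m *ℤ (y *ℤ Es)) *ℤ (T +ℤ m *ℤ (z *ℤ Et))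
         ≡ S *ℤ T +ℤ m *ℤ (y *ℤ Es *ℤ T +ℤ z *ℤ S *ℤ Et) +ℤ y *ℤ Es *ℤ (z *ℤ Et) *ℤ (m *ℤ m)
  expand = solve-∀

pascal : ∀ n k → suc n C suc k ≡ n C k + n C suc k
pascal n k = sym (nCk+nC[k+1]≡[n+1]C[k+1] n k)

absorption : ∀ n k → suc k ℕ.* (suc n C suc k) ≡ suc n ℕ.* (n C k)
absorption n       zero    = trans (ℕ.*-identityˡ _) (trans (nC1≡n (suc n)) (sym (ℕ.*-identityʳ (suc n))))
absorption zero    (suc k) = ℕ.*-zeroʳ (suc (suc k))
absorption (suc n) (suc k) = begin
  suc (suc k) ℕ.* (suc (suc n) C suc (suc k))
    ≡⟨ cong (suc (suc k) ℕ.*_) (pascal (suc n) (suc k)) ⟩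
  suc (suc k) ℕ.* (suc n C suc k + suc n C suc (suc k))
    ≡⟨ split (suc k) (suc n C suc k) (suc n C suc (suc k)) ⟩
  suc k ℕ.* (suc n C suc k) + suc n C suc k + suc (suc k) ℕ.* (suc n C suc (suc k))
    ≡⟨ cong₂ (λ a b → a + suc n C suc k + b) (absorption n k) (absorption n (suc k)) ⟩
  suc n ℕ.* (n C k) + suc n C suc k + suc n ℕ.* (n C suc k)
    ≡⟨ merge (suc n) (n C k) (n C suc k) (suc n C suc k) ⟩
  suc n ℕ.* (n C k + n C suc k) + suc n C suc k
    ≡⟨ cong (λ c → suc n ℕ.* c + suc n C suc k) (sym (pascal n k)) ⟩
  suc n ℕ.* (suc n C suc k) + suc n C suc k
    ≡⟨ ℕ.+-comm (suc n ℕ.* (suc n C suc k)) _ ⟩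
  suc (suc n) ℕ.* (suc n C suc k) ∎
  where
  open ≡-Reasoning
  split : ∀ x a b → (1 + x) ℕ.* (a + b) ≡ x ℕ.* a + a + (1 + x) ℕ.* b
  split = ℕ-Solver.solve-∀
  merge : ∀ x a b c → x ℕ.* a + c + x ℕ.* b ≡ x ℕ.* (a + b) + c
  merge = ℕ-Solver.solve-∀

binomial-factorials : ∀ m k → ((m + k) C k) ℕ.* (k ! ℕ.* m !) ≡ (m + k) !
binomial-factorials m k = begin
  ((m + k) C k) ℕ.* (k ! ℕ.* m !)        ≡⟨ cong (λ j → ((m + k) C k) ℕ.* (k ! ℕ.* j !)) (sym (ℕ.m+n∸n≡m m k)) ⟩
  ((m + k) C k) ℕ.* D                    ≡⟨ cong (ℕ._* D) (nCk≡n!/k![n-k]! k≤m+k) ⟩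
  ((m + k) ! / D) ℕ.* D                  ≡⟨ m/n*n≡m (k![n∸k]!∣n! k≤m+k) ⟩
  (m + k) !                              ∎
  where
  open ≡-Reasoning
  k≤m+k : k ≤ m + k
  k≤m+k = ℕ.m≤n+m k m
  D : ℕ
  D = k ! ℕ.* (m + k ∸ k) !
  instance
    D≢0 : NonZero D
    D≢0 = ℕ._!*_!≢0 k (m + k ∸ k)

binomial-rising : ∀ m k → + ((m + k) C k) *ℤ + (k !) ≡ rising (+ m) k
binomial-rising m k = ℤ.*-cancelˡ-≡ (+ (m !)) _ _ {{m ℕ.!≢0}} (begin
  + (m !) *ℤ (+ ((m + k) C k) *ℤ + (k !))  ≡⟨ rotate (+ (m !)) (+ ((m + k) C k)) (+ (k !)) ⟩
  + ((m + k) C k) *ℤ (+ (k !) *ℤ + (m !))  ≡⟨ sym (cong (+ ((m + k) C k) *ℤ_) (ℤ.pos-* (k !) (m !))) ⟩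
  + ((m + k) C k) *ℤ + (k ! ℕ.* m !)       ≡⟨ sym (ℤ.pos-* ((m + k) C k) (k ! ℕ.* m !)) ⟩
  + (((m + k) C k) ℕ.* (k ! ℕ.* m !))      ≡⟨ cong +_ (binomial-factorials m k) ⟩
  + ((m + k) !)                            ≡⟨ factorial-rising m k ⟩
  + (m !) *ℤ rising (+ m) k                ∎)
  where
  open ≡-Reasoning
  rotate : ∀ a b c → a *ℤ (b *ℤ c) ≡ b *ℤ (c *ℤ a)
  rotate = solve-∀

-- C(u + v + s + t, u + s) (u + 1)⋯(u + s) (v + 1)⋯(v + t)
--   = C(u + v, u) (u + v + 1)⋯(u + v + s + t),
-- since multiplying either side by u! v! gives (u + v + s + t)!.  This exact
-- relation is what is expanded modulo p² at u = p b, v = p c.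
binomial-rising-product : ∀ u v s t →
  + ((u + v + (s + t)) C (u + s)) *ℤ (rising (+ u) s *ℤ rising (+ v) t)
    ≡ + ((u + v) C u) *ℤ rising (+ (u + v)) (s + t)
binomial-rising-product u v s t = ℤ.*-cancelʳ-≡ _ _ (+ (u ! ℕ.* v !)) {{ℕ._!*_!≢0 u v}}
  (trans left (sym right))
  where
  open ≡-Reasoning
  N : ℕ
  N = u + v + (s + t)
  N≡ : v + t + (u + s) ≡ N
  N≡ = solve u v s t
    where
    solve : ∀ u v s t → v + t + (u + s) ≡ u + v + (s + t)
    solve = ℕ-Solver.solve-∀
  left : + (N C (u + s)) *ℤ (rising (+ u) s *ℤ rising (+ v) t) *ℤ + (u ! ℕ.* v !) ≡ + (N !)
  left = begin
    + (N C (u + s)) *ℤ (rising (+ u) s *ℤ rising (+ v) t) *ℤ + (u ! ℕ.* v !)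
      ≡⟨ cong (+ (N C (u + s)) *ℤ (rising (+ u) s *ℤ rising (+ v) t) *ℤ_) (ℤ.pos-* (u !) (v !)) ⟩
    + (N C (u + s)) *ℤ (rising (+ u) s *ℤ rising (+ v) t) *ℤ (+ (u !) *ℤ + (v !))
      ≡⟨ regroup (+ (N C (u + s))) (rising (+ u) s) (rising (+ v) t) (+ (u !)) (+ (v !)) ⟩
    + (N C (u + s)) *ℤ ((+ (u !) *ℤ rising (+ u) s) *ℤ (+ (v !) *ℤ rising (+ v) t))
      ≡⟨ cong₂ (λ a b → + (N C (u + s)) *ℤ (a *ℤ b)) (sym (factorial-rising u s)) (sym (factorial-rising v t)) ⟩
    + (N C (u + s)) *ℤ (+ ((u + s) !) *ℤ + ((v + t) !))
      ≡⟨ sym (trans (ℤ.pos-* (N C (u + s)) _) (cong (+ (N C (u + s)) *ℤ_) (ℤ.pos-* ((u + s) !) ((v + t) !)))) ⟩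
    + ((N C (u + s)) ℕ.* ((u + s) ! ℕ.* (v + t) !))
      ≡⟨ cong (λ n → + ((n C (u + s)) ℕ.* ((u + s) ! ℕ.* (v + t) !))) (sym N≡) ⟩
    + (((v + t + (u + s)) C (u + s)) ℕ.* ((u + s) ! ℕ.* (v + t) !))
      ≡⟨ cong +_ (binomial-factorials (v + t) (u + s)) ⟩
    + ((v + t + (u + s)) !)
      ≡⟨ cong (λ n → + (n !)) N≡ ⟩
    + (N !) ∎
    where
    regroup : ∀ c a b f g → c *ℤ (a *ℤ b) *ℤ (f *ℤ g) ≡ c *ℤ ((f *ℤ a) *ℤ (g *ℤ b))
    regroup = solve-∀
  right : + ((u + v) C u) *ℤ rising (+ (u + v)) (s + t) *ℤ + (u ! ℕ.* v !) ≡ + (N !)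
  right = begin
    + ((u + v) C u) *ℤ rising (+ (u + v)) (s + t) *ℤ + (u ! ℕ.* v !)
      ≡⟨ swap (+ ((u + v) C u)) (rising (+ (u + v)) (s + t)) (+ (u ! ℕ.* v !)) ⟩
    + ((u + v) C u) *ℤ + (u ! ℕ.* v !) *ℤ rising (+ (u + v)) (s + t)
      ≡⟨ cong (_*ℤ rising (+ (u + v)) (s + t)) (sym (ℤ.pos-* ((u + v) C u) (u ! ℕ.* v !))) ⟩
    + (((u + v) C u) ℕ.* (u ! ℕ.* v !)) *ℤ rising (+ (u + v)) (s + t)
      ≡⟨ cong (λ n → + n *ℤ rising (+ (u + v)) (s + t))
              (trans (cong (λ n → (n C u) ℕ.* (u ! ℕ.* v !)) (ℕ.+-comm u v)) (binomial-factorials v u)) ⟩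
    + ((v + u) !) *ℤ rising (+ (u + v)) (s + t)
      ≡⟨ cong (λ n → + (n !) *ℤ rising (+ (u + v)) (s + t)) (ℕ.+-comm v u) ⟩
    + ((u + v) !) *ℤ rising (+ (u + v)) (s + t)
      ≡⟨ sym (factorial-rising (u + v) (s + t)) ⟩
    + (N !) ∎
    where
    swap : ∀ a b c → a *ℤ b *ℤ c ≡ a *ℤ c *ℤ b
    swap = solve-∀

factorial-split : ∀ s t → + ((s + t) !) ≡ + ((s + t) C s) *ℤ (+ (s !) *ℤ + (t !))
factorial-split s t = begin
  + ((s + t) !)                                   ≡⟨ cong (λ n → + (n !)) (ℕ.+-comm s t) ⟩
  + ((t + s) !)                                   ≡⟨ cong +_ (sym (binomial-factorials t s)) ⟩
  + (((t + s) C s) ℕ.* (s ! ℕ.* t !))             ≡⟨ cong (λ n → + ((n C s) ℕ.* (s ! ℕ.* t !))) (ℕ.+-comm t s) ⟩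
  + (((s + t) C s) ℕ.* (s ! ℕ.* t !))             ≡⟨ trans (ℤ.pos-* ((s + t) C s) _) (cong (+ ((s + t) C s) *ℤ_) (ℤ.pos-* (s !) (t !))) ⟩
  + ((s + t) C s) *ℤ (+ (s !) *ℤ + (t !))         ∎
  where open ≡-Reasoning

binomial-sym : ∀ s t → (s + t) C s ≡ (t + s) C t
binomial-sym s t = trans (nCk≡nC[n∸k] (ℕ.m≤m+n s t))
                         (cong₂ _C_ (ℕ.+-comm s t) (ℕ.m+n∸m≡n s t))

sumTo : ℕ → (ℕ → ℕ) → ℕ
sumTo zero    f = 0
sumTo (suc m) f = f 0 + sumTo m (λ j → f (suc j))

sumTo-snoc : ∀ m f → sumTo (suc m) f ≡ sumTo m f + f m
sumTo-snoc zero    f = ℕ.+-comm (f 0) 0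
sumTo-snoc (suc m) f = trans (cong (_+_ (f 0)) (sumTo-snoc m (λ j → f (suc j))))
                             (sym (ℕ.+-assoc (f 0) _ _))

sumTo-cong : ∀ m {f g} → (∀ j → f j ≡ g j) → sumTo m f ≡ sumTo m g
sumTo-cong zero    f≡g = refl
sumTo-cong (suc m) f≡g = cong₂ _+_ (f≡g 0) (sumTo-cong m (λ j → f≡g (suc j)))

sumTo-+ : ∀ m f g → sumTo m f + sumTo m g ≡ sumTo m (λ j → f j + g j)
sumTo-+ zero    f g = refl
sumTo-+ (suc m) f g = trans (interchange (f 0) (sumTo m (λ j → f (suc j))) (g 0) (sumTo m (λ j → g (suc j))))
                            (cong (_+_ (f 0 + g 0)) (sumTo-+ m (λ j → f (suc j)) (λ j → g (suc j))))
  where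
  interchange : ∀ a b c d → a + b + (c + d) ≡ a + c + (b + d)
  interchange = ℕ-Solver.solve-∀

sumTo-∣ : ∀ {d} m f → (∀ j → j < m → d ℕ.∣ f j) → d ℕ.∣ sumTo m f
sumTo-∣ {d} zero    f d∣f = d ℕ.∣0
sumTo-∣     (suc m) f d∣f = ℕ.∣m∣n⇒∣m+n (d∣f 0 ℕ.z<s) (sumTo-∣ m (λ j → f (suc j)) (λ j j<m → d∣f (suc j) (ℕ.s<s j<m)))

vandermonde : ∀ m n k → (n + m) C (k + m) ≡ sumTo (suc m) (λ j → (m C j) ℕ.* (n C (k + j)))
vandermonde zero n k rewrite ℕ.+-identityʳ n | ℕ.+-identityʳ k = sym (trans (ℕ.+-identityʳ _) (ℕ.+-identityʳ _))
vandermonde (suc m) n k rewrite ℕ.+-suc n m | ℕ.+-suc k m = begin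
  suc (n + m) C suc (k + m)                          ≡⟨ pascal (n + m) (k + m) ⟩
  (n + m) C (k + m) + (n + m) C (suc k + m)          ≡⟨ cong₂ _+_ (vandermonde m n k) (vandermonde m n (suc k)) ⟩
  sumTo (suc m) f + sumTo (suc m) g                  ≡⟨ cong (_+ sumTo (suc m) g) (sym (ℕ.+-identityʳ (sumTo (suc m) f))) ⟩
  sumTo (suc m) f + 0 + sumTo (suc m) g              ≡⟨ cong (λ x → sumTo (suc m) f + x + sumTo (suc m) g) (sym f[1+m]≡0) ⟩
  sumTo (suc m) f + f (suc m) + sumTo (suc m) g      ≡⟨ cong (_+ sumTo (suc m) g) (sym (sumTo-snoc (suc m) f)) ⟩
  sumTo (suc (suc m)) f + sumTo (suc m) g            ≡⟨ ℕ.+-assoc (f 0) _ _ ⟩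
  f 0 + (sumTo (suc m) (λ j → f (suc j)) + sumTo (suc m) g)
    ≡⟨ cong (_+_ (f 0)) (sumTo-+ (suc m) (λ j → f (suc j)) g) ⟩
  f 0 + sumTo (suc m) (λ j → f (suc j) + g j)
    ≡⟨ cong (_+_ (f 0)) (sumTo-cong (suc m) combine) ⟩
  sumTo (suc (suc m)) (λ j → (suc m C j) ℕ.* (n C (k + j))) ∎
  where
  open ≡-Reasoning
  f g : ℕ → ℕ
  f j = (m C j) ℕ.* (n C (k + j))
  g j = (m C j) ℕ.* (n C (suc k + j))
  f[1+m]≡0 : f (suc m) ≡ 0
  f[1+m]≡0 = cong (ℕ._* (n C (k + suc m))) (k>n⇒nCk≡0 (ℕ.n<1+n m))
  combine : ∀ j → f (suc j) + g j ≡ (suc m C suc j) ℕ.* (n C (k + suc j))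
  combine j = begin
    (m C suc j) ℕ.* (n C (k + suc j)) + (m C j) ℕ.* (n C (suc k + j))
      ≡⟨ cong (λ i → (m C suc j) ℕ.* (n C (k + suc j)) + (m C j) ℕ.* (n C i)) (sym (ℕ.+-suc k j)) ⟩
    (m C suc j) ℕ.* (n C (k + suc j)) + (m C j) ℕ.* (n C (k + suc j))
      ≡⟨ sym (ℕ.*-distribʳ-+ (n C (k + suc j)) (m C suc j) (m C j)) ⟩
    (m C suc j + m C j) ℕ.* (n C (k + suc j))
      ≡⟨ cong (ℕ._* (n C (k + suc j))) (trans (ℕ.+-comm (m C suc j) (m C j)) (sym (pascal m j))) ⟩
    (suc m C suc j) ℕ.* (n C (k + suc j)) ∎

vandermonde-mod : ∀ d m n k .{{_ : NonZero m}} → (∀ j → 0 < j → j < m → d ℕ.∣ (m C j) ℕ.* (n C (k + j))) →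
  + ((n + m) C (k + m)) ≡ + (n C k) +ℤ + (n C (k + m)) [mod d ]
vandermonde-mod d (suc m) n k d∣inner = ∣⇒≡[mod] {x = + ((n + suc m) C (k + suc m))} {+ (n C k) +ℤ + (n C (k + suc m))}
  (subst (+ d ∣_) (sym difference) (∣ᵤ⇒∣ (sumTo-∣ m inner (λ j j<m → d∣inner (suc j) ℕ.z<s (ℕ.s<s j<m)))))
  where
  open ≡-Reasoning
  f : ℕ → ℕ
  f j = (suc m C j) ℕ.* (n C (k + j))
  inner : ℕ → ℕ
  inner j = f (suc j)
  M : ℕ
  M = sumTo m inner
  outer : (n + suc m) C (k + suc m) ≡ n C k + M + n C (k + suc m)
  outer = begin
    (n + suc m) C (k + suc m)                         ≡⟨ vandermonde (suc m) n k ⟩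
    f 0 + sumTo (suc m) inner                         ≡⟨ cong (_+_ (f 0)) (sumTo-snoc m inner) ⟩
    f 0 + (M + f (suc m))                             ≡⟨ sym (ℕ.+-assoc (f 0) M (f (suc m))) ⟩
    f 0 + M + f (suc m)                               ≡⟨ cong₂ (λ a b → a + M + b) first last ⟩
    n C k + M + n C (k + suc m)                       ∎
    where
    first : f 0 ≡ n C k
    first = trans (ℕ.+-identityʳ _) (cong (n C_) (ℕ.+-identityʳ k))
    last : f (suc m) ≡ n C (k + suc m)
    last = trans (cong (ℕ._* (n C (k + suc m))) (nCn≡1 (suc m))) (ℕ.*-identityˡ _)
  difference : + ((n + suc m) C (k + suc m)) - (+ (n C k) +ℤ + (n C (k + suc m))) ≡ + M
  difference = begin
    + ((n + suc m) C (k + suc m)) - (+ (n C k) +ℤ + (n C (k + suc m)))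
      ≡⟨ cong (λ x → + x - (+ (n C k) +ℤ + (n C (k + suc m)))) outer ⟩
    + (n C k + M + n C (k + suc m)) - (+ (n C k) +ℤ + (n C (k + suc m)))
      ≡⟨ cong (_- (+ (n C k) +ℤ + (n C (k + suc m))))
              (trans (ℤ.pos-+ (n C k + M) _) (cong (_+ℤ + (n C (k + suc m))) (ℤ.pos-+ (n C k) M))) ⟩
    + (n C k) +ℤ + M +ℤ + (n C (k + suc m)) - (+ (n C k) +ℤ + (n C (k + suc m)))
      ≡⟨ cancel (+ (n C k)) (+ M) (+ (n C (k + suc m))) ⟩
    + M ∎
    where
    cancel : ∀ a b c → a +ℤ b +ℤ c - (a +ℤ c) ≡ b
    cancel = solve-∀

-- defect s t / (s + t)! = H(s + t) - H(s) (harmonic numbers): the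
-- first-order obstruction to C(p b + p c + s + t, p b + s) ≡ C(b + c, b) C(s + t, s).
defect : ℕ → ℕ → ℤ
defect s t = + linearCoeff (s + t) - + ((s + t) C s) *ℤ + (t !) *ℤ + linearCoeff s

defect-swap : ∀ s t → defect t s ≡ + linearCoeff (s + t) - + ((s + t) C s) *ℤ + (s !) *ℤ + linearCoeff t
defect-swap s t = cong₂ (λ n x → + linearCoeff n - + x *ℤ + (s !) *ℤ + linearCoeff t)
                        (ℕ.+-comm t s) (sym (binomial-sym s t))

below-block : ∀ p {a b} r s → r < p → a < b → p * a + r < p * b + s
below-block p {a} {b} r s r<p a<b = begin-strict
  p * a + r    <⟨ ℕ.+-monoʳ-< (p * a) r<p ⟩
  p * a + p    ≡⟨ trans (ℕ.+-comm (p * a) p) (sym (ℕ.*-suc p a)) ⟩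
  p * suc a    ≤⟨ ℕ.*-monoʳ-≤ p a<b ⟩
  p * b        ≤⟨ ℕ.m≤m+n (p * b) s ⟩
  p * b + s    ∎
  where open ℕ.≤-Reasoning

AllInstances : ℕ → ℕ → ℕ → Set
AllInstances p r s = ∀ a b → + ((p * a + r) C (p * b + s)) ≡ + ((a C b) * (r C s)) [mod p ^ 2 ]

-- The conditions of the theorem, with k, u, v standing for r - s, p - 1 - s
-- and p - 1 - r + s.
Conditions : ℕ → ℕ → ℕ → ℕ → ℕ → ℕ → Set
Conditions p r s k u v = (+ (r C s) ≡ sign k *ℤ + (u C k) [mod p ^ 2 ])
                         × (sign k *ℤ + (u C k) ≡ sign s *ℤ + (v C s) [mod p ^ 2 ])

conditions-subst : ∀ p r s {k k′ u u′ v v′} → (k , u , v) ≡ (k′ , u′ , v′) →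
  Conditions p r s k u v → Conditions p r s k′ u′ v′
conditions-subst p r s refl conditions = conditions

module _ {p : ℕ} (prime : Prime p) where

  private
    P : ℤ
    P = + p

    instance
      p≢0 : NonZero p
      p≢0 = prime⇒nonZero prime

  ∣-cancel : ∀ {x z} → ¬ P ∣ z → P ∣ x *ℤ z → P ∣ x
  ∣-cancel {x} {z} p∤z p∣xz
    with euclidsLemma ℤ.∣ x ∣ ℤ.∣ z ∣ prime (subst (p ℕ.∣_) (ℤ.abs-* x z) (∣⇒∣ᵤ p∣xz))
  ... | inj₁ p∣x = ∣ᵤ⇒∣ p∣x
  ... | inj₂ p∣z = ⊥-elim (p∤z (∣ᵤ⇒∣ p∣z))

  p²∣p*x⇔p∣x : ∀ x → + (p ^ 2) ∣ P *ℤ x ⇔ P ∣ x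
  p²∣p*x⇔p∣x x = mk⇔ (λ d → *-cancelˡ-∣ P (subst (_∣ P *ℤ x) (square p) d))
                     (λ d → subst (_∣ P *ℤ x) (sym (square p)) (*-monoʳ-∣ P d))

  prime∤factorial : ∀ n → n < p → ¬ p ℕ.∣ n !
  prime∤factorial zero    _   p∣1 = ¬prime[1] (subst Prime (ℕ.∣1⇒≡1 p∣1) prime)
  prime∤factorial (suc n) n<p p∣n!
    with euclidsLemma (suc n) (n !) prime p∣n!
  ... | inj₁ p∣1+n = ℕ.<⇒≱ n<p (ℕ.∣⇒≤ p∣1+n)
  ... | inj₂ p∣n!  = prime∤factorial n (ℕ.<-trans (ℕ.n<1+n n) n<p) p∣n!

  prime∤factorials : ∀ {s t} → s < p → t < p → ¬ P ∣ + (s !) *ℤ + (t !)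
  prime∤factorials {s} {t} s<p t<p p∣s!t! =
    prime∤factorial s s<p (∣⇒∣ᵤ (∣-cancel {x = + (s !)} {+ (t !)} (λ p∣t! → prime∤factorial t t<p (∣⇒∣ᵤ p∣t!)) p∣s!t!))

  -- If  L (Z + p u) ≡ B (X Z + p v)
  -- modulo p² with p ∤ Z, then modulo p it reads (L - B X) Z ≡ 0, so
  -- L - B X = p q; the p-linear part then reads  q Z ≡ B (v - X u)  (mod p).
  first-order-quotient : ∀ {L B X Z u v} → ¬ P ∣ Z →
    L *ℤ (Z +ℤ P *ℤ u) ≡ B *ℤ (X *ℤ Z +ℤ P *ℤ v) [mod p ^ 2 ] →
    Σ ℤ λ q → L - B *ℤ X ≡ P *ℤ q × P ∣ q *ℤ Z - B *ℤ (v - X *ℤ u)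
  first-order-quotient {L} {B} {X} {Z} {u} {v} p∤Z congruence = q , L-BX≡Pq , p∣qZ-w
    where
    Δ : ℤ
    Δ = L *ℤ (Z +ℤ P *ℤ u) - B *ℤ (X *ℤ Z +ℤ P *ℤ v)

    p²∣Δ : + (p ^ 2) ∣ Δ
    p²∣Δ = ≡[mod]⇒∣ {x = L *ℤ (Z +ℤ P *ℤ u)} {B *ℤ (X *ℤ Z +ℤ P *ℤ v)} congruence

    split : ∀ L B X Z u v P → L *ℤ (Z +ℤ P *ℤ u) - B *ℤ (X *ℤ Z +ℤ P *ℤ v)
                            ≡ (L - B *ℤ X) *ℤ Z +ℤ P *ℤ (L *ℤ u - B *ℤ v)
    split = solve-∀

    p∣L-BX : P ∣ L - B *ℤ X
    p∣L-BX = ∣-cancel p∤Z (∣m+n∣n⇒∣m (subst (P ∣_) (split L B X Z u v P) (∣-trans (divides P (square p)) p²∣Δ))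
                                      (∣m⇒∣m*n (L *ℤ u - B *ℤ v) ∣-refl))

    q : ℤ
    q = _∣_.quotient p∣L-BX

    L-BX≡Pq : L - B *ℤ X ≡ P *ℤ q
    L-BX≡Pq = trans (_∣_.equality p∣L-BX) (ℤ.*-comm q P)

    expand : ∀ B X q Z u v P → (B *ℤ X +ℤ P *ℤ q) *ℤ (Z +ℤ P *ℤ u) - B *ℤ (X *ℤ Z +ℤ P *ℤ v)
                             ≡ P *ℤ (q *ℤ Z - B *ℤ (v - X *ℤ u)) +ℤ q *ℤ u *ℤ (P *ℤ P)
    expand = solve-∀

    Δ≡ : Δ ≡ P *ℤ (q *ℤ Z - B *ℤ (v - X *ℤ u)) +ℤ q *ℤ u *ℤ + (p ^ 2)
    Δ≡ = begin
      Δ ≡⟨ cong (λ l → l *ℤ (Z +ℤ P *ℤ u) - B *ℤ (X *ℤ Z +ℤ P *ℤ v)) (trans (shift L (B *ℤ X)) (cong (B *ℤ X +ℤ_) L-BX≡Pq)) ⟩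
      (B *ℤ X +ℤ P *ℤ q) *ℤ (Z +ℤ P *ℤ u) - B *ℤ (X *ℤ Z +ℤ P *ℤ v) ≡⟨ expand B X q Z u v P ⟩
      P *ℤ (q *ℤ Z - B *ℤ (v - X *ℤ u)) +ℤ q *ℤ u *ℤ (P *ℤ P)
        ≡⟨ cong (λ k → P *ℤ (q *ℤ Z - B *ℤ (v - X *ℤ u)) +ℤ q *ℤ u *ℤ k) (sym (square p)) ⟩
      P *ℤ (q *ℤ Z - B *ℤ (v - X *ℤ u)) +ℤ q *ℤ u *ℤ + (p ^ 2)      ∎
      where
      open ≡-Reasoning
      shift : ∀ x y → x ≡ y +ℤ (x - y)
      shift = solve-∀

    p∣qZ-w : P ∣ q *ℤ Z - B *ℤ (v - X *ℤ u)
    p∣qZ-w = Equivalence.to (p²∣p*x⇔p∣x (q *ℤ Z - B *ℤ (v - X *ℤ u)))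
               (∣m+n∣n⇒∣m (subst (+ (p ^ 2) ∣_) Δ≡ p²∣Δ) (divides (q *ℤ u) refl))

  -- Linearisation: under the hypotheses above,
  -- L ≡ B X (mod p²)  ⇔  p ∣ q  ⇔  p ∣ q Z  ⇔  p ∣ B (v - X u).
  linearisation : ∀ {L B X Z u v} → ¬ P ∣ Z →
    L *ℤ (Z +ℤ P *ℤ u) ≡ B *ℤ (X *ℤ Z +ℤ P *ℤ v) [mod p ^ 2 ] →
    L ≡ B *ℤ X [mod p ^ 2 ] ⇔ P ∣ B *ℤ (v - X *ℤ u)
  linearisation {L} {B} {X} {Z} {u} {v} p∤Z congruence = mk⇔
    (λ L≡BX → subst (P ∣_) (cancel (q *ℤ Z) w) (∣m∣n⇒∣m-n (∣m⇒∣m*n Z (Equivalence.to p²∣L-BX⇔p∣q L≡BX)) p∣qZ-w))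
    (λ p∣w → Equivalence.from p²∣L-BX⇔p∣q (∣-cancel p∤Z (subst (P ∣_) (restore (q *ℤ Z) w) (∣m∣n⇒∣m+n p∣qZ-w p∣w))))
    where
    reduction : Σ ℤ λ q → L - B *ℤ X ≡ P *ℤ q × P ∣ q *ℤ Z - B *ℤ (v - X *ℤ u)
    reduction = first-order-quotient {L} {B} {X} {Z} {u} {v} p∤Z congruence
    q : ℤ
    q = proj₁ reduction
    L-BX≡Pq : L - B *ℤ X ≡ P *ℤ q
    L-BX≡Pq = proj₁ (proj₂ reduction)
    w : ℤ
    w = B *ℤ (v - X *ℤ u)
    p∣qZ-w : P ∣ q *ℤ Z - w
    p∣qZ-w = proj₂ (proj₂ reduction)
    cancel : ∀ a b → a - (a - b) ≡ b
    cancel = solve-∀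
    restore : ∀ a b → a - b +ℤ b ≡ a
    restore = solve-∀
    p²∣L-BX⇔p∣q : L ≡ B *ℤ X [mod p ^ 2 ] ⇔ P ∣ q
    p²∣L-BX⇔p∣q = mk⇔
      (λ L≡BX → Equivalence.to (p²∣p*x⇔p∣x q) (subst (+ (p ^ 2) ∣_) L-BX≡Pq (≡[mod]⇒∣ {x = L} {B *ℤ X} L≡BX)))
      (λ p∣q → ∣⇒≡[mod] {x = L} {B *ℤ X} (subst (+ (p ^ 2) ∣_) (sym L-BX≡Pq) (Equivalence.from (p²∣p*x⇔p∣x q) p∣q)))

  -- p divides C(n, k) whenever p ∣ n and p ∤ k, by absorption and Euclid.
  p∣binomial : ∀ n k → p ℕ.∣ n → ¬ p ℕ.∣ k → p ℕ.∣ n C k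
  p∣binomial n       zero    _   p∤0 = ⊥-elim (p∤0 (p ℕ.∣0))
  p∣binomial zero    (suc k) _   _   = p ℕ.∣0
  p∣binomial (suc n) (suc k) p∣n p∤k
    with euclidsLemma (suc k) (suc n C suc k) prime
           (subst (p ℕ.∣_) (sym (absorption n k)) (ℕ.∣m⇒∣m*n (n C k) p∣n))
  ... | inj₁ p∣k = ⊥-elim (p∤k p∣k)
  ... | inj₂ p∣C = p∣C

  p∤nonmultiple : ∀ b j → 0 < j → j < p → ¬ p ℕ.∣ p ℕ.* b + j
  p∤nonmultiple b j 0<j j<p p∣pb+j = ℕ.<⇒≱ j<p (ℕ.∣⇒≤ {{ℕ.>-nonZero 0<j}} (ℕ.∣m+n∣m⇒∣n p∣pb+j (ℕ.m∣m*n b)))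

  -- C(p a, p b) ≡ C(a, b)  (mod p²), by induction with Pascal's rule: in
  -- Vandermonde's expansion of C(p a + p, p b + p) all inner terms
  -- C(p, j) C(p a, p b + j), 0 < j < p, are products of two multiples of p.
  binomial-mod-p² : ∀ a b → + ((p ℕ.* a) C (p ℕ.* b)) ≡ + (a C b) [mod p ^ 2 ]
  binomial-mod-p² a zero rewrite ℕ.*-zeroʳ p = ≡⇒≡[mod] {x = + 1} refl
  binomial-mod-p² zero (suc b) rewrite ℕ.*-zeroʳ p
    | k>n⇒nCk≡0 (ℕ.>-nonZero⁻¹ (p ℕ.* suc b) {{ℕ.m*n≢0 p (suc b)}}) = ≡⇒≡[mod] {x = + 0} refl
  binomial-mod-p² (suc a) (suc b) = begin
    + ((p ℕ.* suc a) C (p ℕ.* suc b))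
      ≡⟨ cong₂ (λ n k → + (n C k)) (pa+p a) (pa+p b) ⟩
    + ((p ℕ.* a + p) C (p ℕ.* b + p))
      ≈⟨ vandermonde-mod (p ^ 2) p (p ℕ.* a) (p ℕ.* b) inner-terms ⟩
    + ((p ℕ.* a) C (p ℕ.* b)) +ℤ + ((p ℕ.* a) C (p ℕ.* b + p))
      ≡⟨ cong (λ k → + ((p ℕ.* a) C (p ℕ.* b)) +ℤ + ((p ℕ.* a) C k)) (sym (pa+p b)) ⟩
    + ((p ℕ.* a) C (p ℕ.* b)) +ℤ + ((p ℕ.* a) C (p ℕ.* suc b))
      ≈⟨ +-cong[mod] {x = + ((p ℕ.* a) C (p ℕ.* b))} {+ (a C b)} {+ ((p ℕ.* a) C (p ℕ.* suc b))} {+ (a C suc b)}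
                     (binomial-mod-p² a b) (binomial-mod-p² a (suc b)) ⟩
    + (a C b) +ℤ + (a C suc b)
      ≡⟨ sym (trans (cong +_ (pascal a b)) (ℤ.pos-+ (a C b) (a C suc b))) ⟩
    + (suc a C suc b) ∎
    where
    open import Relation.Binary.Reasoning.Setoid (≡[mod]-setoid (p ^ 2))
    pa+p : ∀ a → p ℕ.* suc a ≡ p ℕ.* a + p
    pa+p a = trans (ℕ.*-suc p a) (ℕ.+-comm p (p ℕ.* a))
    inner-terms : ∀ j → 0 < j → j < p → p ^ 2 ℕ.∣ (p C j) ℕ.* ((p ℕ.* a) C (p ℕ.* b + j))
    inner-terms j 0<j j<p = subst (ℕ._∣ (p C j) ℕ.* ((p ℕ.* a) C (p ℕ.* b + j))) (cong (p ℕ.*_) (sym (ℕ.*-identityʳ p)))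
      (ℕ.*-pres-∣ (p∣binomial p j ℕ.∣-refl (λ p∣j → ℕ.<⇒≱ j<p (ℕ.∣⇒≤ {{ℕ.>-nonZero 0<j}} p∣j)))
                  (p∣binomial (p ℕ.* a) (p ℕ.* b + j) (ℕ.m∣m*n a) (p∤nonmultiple b j 0<j j<p)))

  product-criterion : ∀ s t b c → s < p → t < p →
    + ((p ℕ.* (b + c) + (s + t)) C (p ℕ.* b + s)) ≡ + (((b + c) C b) ℕ.* ((s + t) C s)) [mod p ^ 2 ]
    ⇔ P ∣ + ((b + c) C b) *ℤ (+ b *ℤ defect s t +ℤ + c *ℤ defect t s)
  product-criterion s t b c s<p t<p =
    subst₂ (λ y w → (L ≡ y [mod p ^ 2 ]) ⇔ (P ∣ w)) (sym (ℤ.pos-* ((b + c) C b) ((s + t) C s))) (cong (B *ℤ_) linear-part)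
      (linearisation {L} {B} {X} {S *ℤ T} {u} {v} (prime∤factorials s<p t<p) first-order)
    where
    L B X S T Es Et E : ℤ
    L = + ((p ℕ.* (b + c) + (s + t)) C (p ℕ.* b + s))
    B = + ((b + c) C b)
    X = + ((s + t) C s)
    S = + (s !)
    T = + (t !)
    Es = + linearCoeff s
    Et = + linearCoeff t
    E = + linearCoeff (s + t)
    u v : ℤ
    u = + b *ℤ Es *ℤ T +ℤ + c *ℤ S *ℤ Et
    v = (+ b +ℤ + c) *ℤ E

    distrib : p ℕ.* (b + c) ≡ p ℕ.* b + p ℕ.* c
    distrib = ℕ.*-distribˡ-+ p b c

    exact : L *ℤ (rising (P *ℤ + b) s *ℤ rising (P *ℤ + c) t)
          ≡ + ((p ℕ.* (b + c)) C (p ℕ.* b)) *ℤ rising (P *ℤ (+ b +ℤ + c)) (s + t)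
    exact = begin
      L *ℤ (rising (P *ℤ + b) s *ℤ rising (P *ℤ + c) t)
        ≡⟨ cong₂ (λ x y → L *ℤ (rising x s *ℤ rising y t)) (sym (ℤ.pos-* p b)) (sym (ℤ.pos-* p c)) ⟩
      L *ℤ (rising (+ (p ℕ.* b)) s *ℤ rising (+ (p ℕ.* c)) t)
        ≡⟨ cong (λ n → + ((n + (s + t)) C (p ℕ.* b + s)) *ℤ (rising (+ (p ℕ.* b)) s *ℤ rising (+ (p ℕ.* c)) t)) distrib ⟩
      + ((p ℕ.* b + p ℕ.* c + (s + t)) C (p ℕ.* b + s)) *ℤ (rising (+ (p ℕ.* b)) s *ℤ rising (+ (p ℕ.* c)) t)
        ≡⟨ binomial-rising-product (p ℕ.* b) (p ℕ.* c) s t ⟩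
      + ((p ℕ.* b + p ℕ.* c) C (p ℕ.* b)) *ℤ rising (+ (p ℕ.* b + p ℕ.* c)) (s + t)
        ≡⟨ cong (λ n → + (n C (p ℕ.* b)) *ℤ rising (+ n) (s + t)) (sym distrib) ⟩
      + ((p ℕ.* (b + c)) C (p ℕ.* b)) *ℤ rising (+ (p ℕ.* (b + c))) (s + t)
        ≡⟨ cong (λ x → + ((p ℕ.* (b + c)) C (p ℕ.* b)) *ℤ rising x (s + t)) (trans (ℤ.pos-* p (b + c)) (cong (P *ℤ_) (ℤ.pos-+ b c))) ⟩
      + ((p ℕ.* (b + c)) C (p ℕ.* b)) *ℤ rising (P *ℤ (+ b +ℤ + c)) (s + t) ∎
      where open ≡-Reasoning

    first-order : L *ℤ (S *ℤ T +ℤ P *ℤ u) ≡ B *ℤ (X *ℤ (S *ℤ T) +ℤ P *ℤ v) [mod p ^ 2 ]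
    first-order = begin
      L *ℤ (S *ℤ T +ℤ P *ℤ u)
        ≈⟨ *-cong[mod] {x = L} {L} {S *ℤ T +ℤ P *ℤ u} {rising (P *ℤ + b) s *ℤ rising (P *ℤ + c) t}
                       (≡⇒≡[mod] {x = L} refl) (≡[mod]-sym {x = rising (P *ℤ + b) s *ℤ rising (P *ℤ + c) t} {S *ℤ T +ℤ P *ℤ u}
                                                (rising-product-mod-square p (+ b) (+ c) s t)) ⟩
      L *ℤ (rising (P *ℤ + b) s *ℤ rising (P *ℤ + c) t)
        ≡⟨ exact ⟩
      + ((p ℕ.* (b + c)) C (p ℕ.* b)) *ℤ rising (P *ℤ (+ b +ℤ + c)) (s + t)
        ≈⟨ *-cong[mod] {x = + ((p ℕ.* (b + c)) C (p ℕ.* b))} {B} {rising (P *ℤ (+ b +ℤ + c)) (s + t)} {+ ((s + t) !) +ℤ P *ℤ v}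
                       (binomial-mod-p² (b + c) b) (rising-mod-square p (+ b +ℤ + c) (s + t)) ⟩
      B *ℤ (+ ((s + t) !) +ℤ P *ℤ v)
        ≡⟨ cong (λ f → B *ℤ (f +ℤ P *ℤ v)) (factorial-split s t) ⟩
      B *ℤ (X *ℤ (S *ℤ T) +ℤ P *ℤ v) ∎
      where open import Relation.Binary.Reasoning.Setoid (≡[mod]-setoid (p ^ 2))

    linear-part : v - X *ℤ u ≡ + b *ℤ defect s t +ℤ + c *ℤ defect t s
    linear-part = trans (regroup (+ b) (+ c) E X S T Es Et)
                        (cong (λ d → + b *ℤ defect s t +ℤ + c *ℤ d) (sym (defect-swap s t)))
      where
      regroup : ∀ b c E X S T Es Et → (b +ℤ c) *ℤ E - X *ℤ (b *ℤ Es *ℤ T +ℤ c *ℤ S *ℤ Et)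
              ≡ b *ℤ (E - X *ℤ T *ℤ Es) +ℤ c *ℤ (E - X *ℤ S *ℤ Et)
      regroup = solve-∀

  -- By reflection, (-1)ᵗ C(m + t, t) t! is the
  -- rising factorial of length t starting at s - p, so both sides come from
  -- first-order expansions at the multiple -p of p.
  reflection-criterion : ∀ s t m → suc (s + t + m) ≡ p →
    + ((s + t) C s) ≡ sign t *ℤ + ((m + t) C t) [mod p ^ 2 ] ⇔ P ∣ defect s t
  reflection-criterion s t m p≡ =
    mk⇔ (λ X≡Y → ∣-neg⁻ (Equivalence.to criterion (≡[mod]-trans {x = Y} {X} {+ 1 *ℤ X}
                           (≡[mod]-sym {x = X} {Y} X≡Y) (≡⇒≡[mod] {x = X} (sym (ℤ.*-identityˡ X))))))
        (λ p∣d → ≡[mod]-sym {x = Y} {X} (≡[mod]-trans {x = Y} {+ 1 *ℤ X} {X}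
                    (Equivalence.from criterion (∣-neg p∣d)) (≡⇒≡[mod] {x = + 1 *ℤ X} (ℤ.*-identityˡ X))))
    where
    X Y S T Es E x₀ : ℤ
    X = + ((s + t) C s)
    Y = sign t *ℤ + ((m + t) C t)
    S = + (s !)
    T = + (t !)
    Es = + linearCoeff s
    E = + linearCoeff (s + t)
    x₀ = P *ℤ - + 1
    u v : ℤ
    u = - + 1 *ℤ Es *ℤ T
    v = - + 1 *ℤ E

    ∣-neg : ∀ {d} → P ∣ d → P ∣ - d
    ∣-neg = ∣m⇒∣-m

    ∣-neg⁻ : ∀ {d} → P ∣ - d → P ∣ d
    ∣-neg⁻ {d} p∣-d = subst (P ∣_) (ℤ.neg-involutive d) (∣m⇒∣-m p∣-d)

    s<p : s < p
    s<p = subst (s <_) p≡ (ℕ.s≤s (ℕ.≤-trans (ℕ.m≤m+n s t) (ℕ.m≤m+n (s + t) m)))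

    t<p : t < p
    t<p = subst (t <_) p≡ (ℕ.s≤s (ℕ.≤-trans (ℕ.m≤n+m t s) (ℕ.m≤m+n (s + t) m)))

    reflected : Y *ℤ T ≡ rising (x₀ +ℤ + s) t
    reflected = begin
      sign t *ℤ + ((m + t) C t) *ℤ T     ≡⟨ ℤ.*-assoc (sign t) _ T ⟩
      sign t *ℤ (+ ((m + t) C t) *ℤ T)   ≡⟨ cong (sign t *ℤ_) (binomial-rising m t) ⟩
      sign t *ℤ rising (+ m) t           ≡⟨ rising-reflect (+ m) t ⟩
      rising (- + m - + suc t) t         ≡⟨ cong (λ x → rising x t) start ⟩
      rising (x₀ +ℤ + s) t               ∎
      where
      open ≡-Reasoning
      shift : ∀ s t m → - m - (+ 1 +ℤ t) ≡ (+ 1 +ℤ (s +ℤ t +ℤ m)) *ℤ - + 1 +ℤ s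
      shift = solve-∀
      start : - + m - + suc t ≡ x₀ +ℤ + s
      start = begin
        - + m - + suc t                                  ≡⟨ shift (+ s) (+ t) (+ m) ⟩
        (+ 1 +ℤ (+ s +ℤ + t +ℤ + m)) *ℤ - + 1 +ℤ + s      ≡⟨ cong (λ n → (+ 1 +ℤ n) *ℤ - + 1 +ℤ + s) (sym cast) ⟩
        + suc (s + t + m) *ℤ - + 1 +ℤ + s                 ≡⟨ cong (λ n → + n *ℤ - + 1 +ℤ + s) p≡ ⟩
        x₀ +ℤ + s                                        ∎
        where
        cast : + (s + t + m) ≡ + s +ℤ + t +ℤ + m
        cast = trans (ℤ.pos-+ (s + t) m) (cong (_+ℤ + m) (ℤ.pos-+ s t))

    first-order : Y *ℤ (S *ℤ T +ℤ P *ℤ u) ≡ + 1 *ℤ (X *ℤ (S *ℤ T) +ℤ P *ℤ v) [mod p ^ 2 ]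
    first-order = begin
      Y *ℤ (S *ℤ T +ℤ P *ℤ u)                  ≡⟨ regroup Y S T P Es ⟩
      Y *ℤ T *ℤ (S +ℤ P *ℤ (- + 1 *ℤ Es))      ≈⟨ *-cong[mod] {x = Y *ℤ T} {Y *ℤ T} {S +ℤ P *ℤ (- + 1 *ℤ Es)} {rising x₀ s}
                                                              (≡⇒≡[mod] {x = Y *ℤ T} refl)
                                                              (≡[mod]-sym {x = rising x₀ s} {S +ℤ P *ℤ (- + 1 *ℤ Es)}
                                                                          (rising-mod-square p (- + 1) s)) ⟩
      Y *ℤ T *ℤ rising x₀ s                     ≡⟨ cong (_*ℤ rising x₀ s) reflected ⟩
      rising (x₀ +ℤ + s) t *ℤ rising x₀ s       ≡⟨ trans (ℤ.*-comm _ (rising x₀ s)) (sym (rising-+ x₀ s t)) ⟩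
      rising x₀ (s + t)                         ≈⟨ rising-mod-square p (- + 1) (s + t) ⟩
      + ((s + t) !) +ℤ P *ℤ v                   ≡⟨ cong (λ f → f +ℤ P *ℤ v) (factorial-split s t) ⟩
      X *ℤ (S *ℤ T) +ℤ P *ℤ v                   ≡⟨ sym (ℤ.*-identityˡ _) ⟩
      + 1 *ℤ (X *ℤ (S *ℤ T) +ℤ P *ℤ v)         ∎
      where
      open import Relation.Binary.Reasoning.Setoid (≡[mod]-setoid (p ^ 2))
      regroup : ∀ Y S T P Es → Y *ℤ (S *ℤ T +ℤ P *ℤ (- + 1 *ℤ Es *ℤ T)) ≡ Y *ℤ T *ℤ (S +ℤ P *ℤ (- + 1 *ℤ Es))
      regroup = solve-∀

    criterion : Y ≡ + 1 *ℤ X [mod p ^ 2 ] ⇔ P ∣ - defect s t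
    criterion = subst (λ w → (Y ≡ + 1 *ℤ X [mod p ^ 2 ]) ⇔ (P ∣ w)) (linear-part X T Es E)
      (linearisation {Y} {+ 1} {X} {S *ℤ T} {u} {v} (prime∤factorials s<p t<p) first-order)
      where
      linear-part : ∀ X T Es E → + 1 *ℤ (- + 1 *ℤ E - X *ℤ (- + 1 *ℤ Es *ℤ T)) ≡ - (E - X *ℤ T *ℤ Es)
      linear-part = solve-∀

  -- For r < s < p the coefficient C(p + r, s) is divisible by p only once:
  -- C(p + r, s) s! (p + r - s)! = (p + r)! = p · (p - 1)! · (p + 1) ⋯ (p + r),
  -- and (p - 1)! and (p + 1) ⋯ (p + r) ≡ r! are prime to p.
  p²∤binomial : ∀ r s → r < s → s < p → ¬ p ^ 2 ℕ.∣ (p + r) C s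
  p²∤binomial r s r<s s<p p²∣C = prime∤factorial r (ℕ.<-trans r<s s<p) (∣⇒∣ᵤ p∣r!)
    where
    q m : ℕ
    q = ℕ.pred p
    m = p + r ∸ s

    factorisation : + ((p + r) C s) *ℤ + (s ! ℕ.* m !) ≡ P *ℤ (+ (q !) *ℤ rising P r)
    factorisation = begin
      + ((p + r) C s) *ℤ + (s ! ℕ.* m !)        ≡⟨ sym (ℤ.pos-* ((p + r) C s) (s ! ℕ.* m !)) ⟩
      + (((p + r) C s) ℕ.* (s ! ℕ.* m !))       ≡⟨ cong (λ n → + ((n C s) ℕ.* (s ! ℕ.* m !))) (sym m+s≡p+r) ⟩
      + (((m + s) C s) ℕ.* (s ! ℕ.* m !))       ≡⟨ cong +_ (binomial-factorials m s) ⟩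
      + ((m + s) !)                             ≡⟨ cong (λ n → + (n !)) (trans m+s≡p+r (cong (_+ r) (sym (ℕ.suc-pred p)))) ⟩
      + ((suc q + r) !)                         ≡⟨ factorial-rising (suc q) r ⟩
      + (suc q ℕ.* q !) *ℤ rising (+ suc q) r   ≡⟨ cong (_*ℤ rising (+ suc q) r) (ℤ.pos-* (suc q) (q !)) ⟩
      + suc q *ℤ + (q !) *ℤ rising (+ suc q) r  ≡⟨ ℤ.*-assoc (+ suc q) (+ (q !)) _ ⟩
      + suc q *ℤ (+ (q !) *ℤ rising (+ suc q) r) ≡⟨ cong (λ n → + n *ℤ (+ (q !) *ℤ rising (+ n) r)) (ℕ.suc-pred p) ⟩
      P *ℤ (+ (q !) *ℤ rising P r)              ∎
      where
      open ≡-Reasoning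
      m+s≡p+r : m + s ≡ p + r
      m+s≡p+r = ℕ.m∸n+n≡m (ℕ.≤-trans (ℕ.<⇒≤ s<p) (ℕ.m≤m+n p r))

    p∣rising : P ∣ rising P r
    p∣rising = ∣-cancel {rising P r} {+ (q !)}
      (λ p∣q! → prime∤factorial q (subst (q <_) (ℕ.suc-pred p) (ℕ.n<1+n q)) (∣⇒∣ᵤ p∣q!))
      (subst (P ∣_) (ℤ.*-comm (+ (q !)) (rising P r))
        (Equivalence.to (p²∣p*x⇔p∣x (+ (q !) *ℤ rising P r))
          (subst (+ (p ^ 2) ∣_) factorisation (∣m⇒∣m*n {m = + ((p + r) C s)} (+ (s ! ℕ.* m !)) (∣ᵤ⇒∣ p²∣C)))))

    p∣r! : P ∣ + (r !)
    p∣r! = subst (P ∣_) (cancel (rising P r) (+ (r !)))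
             (∣m∣n⇒∣m-n p∣rising (≡[mod]⇒∣ {x = rising P r} {+ (r !)} (rising-mod p r)))
      where
      cancel : ∀ a b → a - (a - b) ≡ b
      cancel = solve-∀

  -- The congruence holds for all a, b exactly when p divides both defects:
  -- the instances (a, b) = (1, 1) and (1, 0) isolate them, and for a < b
  -- both sides vanish.
  all-instances⇔defects : ∀ s t → s + t < p → AllInstances p (s + t) s ⇔ (P ∣ defect s t × P ∣ defect t s)
  all-instances⇔defects s t s+t<p = mk⇔ forward backward
    where
    s<p : s < p
    s<p = ℕ.≤-<-trans (ℕ.m≤m+n s t) s+t<p
    t<p : t < p
    t<p = ℕ.≤-<-trans (ℕ.m≤n+m t s) s+t<p

    forward : AllInstances p (s + t) s → P ∣ defect s t × P ∣ defect t s
    forward holds =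
      subst (P ∣_) (only-first (defect s t) (defect t s)) (Equivalence.to (product-criterion s t 1 0 s<p t<p) (holds 1 1)) ,
      subst (P ∣_) (only-second (defect s t) (defect t s)) (Equivalence.to (product-criterion s t 0 1 s<p t<p) (holds 1 0))
      where
      only-first : ∀ x y → + 1 *ℤ (+ 1 *ℤ x +ℤ + 0 *ℤ y) ≡ x
      only-first = solve-∀
      only-second : ∀ x y → + 1 *ℤ (+ 0 *ℤ x +ℤ + 1 *ℤ y) ≡ y
      only-second = solve-∀

    backward : P ∣ defect s t × P ∣ defect t s → AllInstances p (s + t) s
    backward (p∣dst , p∣dts) a b with b ℕ.≤? a
    ... | yes b≤a with ℕ.m≤n⇒∃[o]m+o≡n b≤a
    ...   | c , refl = Equivalence.from (product-criterion s t b c s<p t<p)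
                         (∣n⇒∣m*n (+ ((b + c) C b)) (∣m∣n⇒∣m+n (∣n⇒∣m*n (+ b) p∣dst) (∣n⇒∣m*n (+ c) p∣dts)))
    backward _ a b | no b≰a
      rewrite k>n⇒nCk≡0 (ℕ.≰⇒> b≰a) | k>n⇒nCk≡0 (below-block p (s + t) s s+t<p (ℕ.≰⇒> b≰a)) = ≡⇒≡[mod] {x = + 0} refl

  characterisation : ∀ s t m → suc (s + t + m) ≡ p →
    AllInstances p (s + t) s ⇔ Conditions p (s + t) s t (m + t) (m + s)
  characterisation s t m p≡ = mk⇔ necessary sufficient
    where
    X Yt Ys : ℤ
    X = + ((s + t) C s)
    Yt = sign t *ℤ + ((m + t) C t)
    Ys = sign s *ℤ + ((m + s) C s)

    all⇔ : AllInstances p (s + t) s ⇔ (P ∣ defect s t × P ∣ defect t s)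
    all⇔ = all-instances⇔defects s t (subst (s + t <_) p≡ (ℕ.s≤s (ℕ.m≤m+n (s + t) m)))

    reflect-t : X ≡ Yt [mod p ^ 2 ] ⇔ P ∣ defect s t
    reflect-t = reflection-criterion s t m p≡

    reflect-s : X ≡ Ys [mod p ^ 2 ] ⇔ P ∣ defect t s
    reflect-s = subst (λ x → (+ x ≡ Ys [mod p ^ 2 ]) ⇔ (P ∣ defect t s)) (sym (binomial-sym s t))
                  (reflection-criterion t s m (trans (cong (λ n → suc (n + m)) (ℕ.+-comm t s)) p≡))

    necessary : AllInstances p (s + t) s → X ≡ Yt [mod p ^ 2 ] × Yt ≡ Ys [mod p ^ 2 ]
    necessary holds = X≡Yt , ≡[mod]-trans {x = Yt} {X} {Ys} (≡[mod]-sym {x = X} {Yt} X≡Yt) X≡Ys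
      where
      X≡Yt : X ≡ Yt [mod p ^ 2 ]
      X≡Yt = Equivalence.from reflect-t (proj₁ (Equivalence.to all⇔ holds))
      X≡Ys : X ≡ Ys [mod p ^ 2 ]
      X≡Ys = Equivalence.from reflect-s (proj₂ (Equivalence.to all⇔ holds))

    sufficient : X ≡ Yt [mod p ^ 2 ] × Yt ≡ Ys [mod p ^ 2 ] → AllInstances p (s + t) s
    sufficient (X≡Yt , Yt≡Ys) = Equivalence.from all⇔
      (Equivalence.to reflect-t X≡Yt , Equivalence.to reflect-s (≡[mod]-trans {x = X} {Yt} {Ys} X≡Yt Yt≡Ys))

instance-1-0 : ∀ p r s → r < s →
  + ((p * 1 + r) C (p * 0 + s)) ≡ + ((1 C 0) * (r C s)) [mod p ^ 2 ] → p ^ 2 ℕ.∣ (p + r) C s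
instance-1-0 p r s r<s holds = subst (p ^ 2 ℕ.∣_) difference holds
  where
  open ≡-Reasoning
  difference : ℤ.∣ + ((p * 1 + r) C (p * 0 + s)) - + ((1 C 0) * (r C s)) ∣ ≡ (p + r) C s
  difference = begin
    ℤ.∣ + ((p * 1 + r) C (p * 0 + s)) - + ((1 C 0) * (r C s)) ∣
      ≡⟨ cong₂ (λ n x → ℤ.∣ + ((n + r) C (p * 0 + s)) - + ((1 C 0) * x) ∣) (ℕ.*-identityʳ p) (k>n⇒nCk≡0 r<s) ⟩
    ℤ.∣ + ((p + r) C (p * 0 + s)) - + 0 ∣
      ≡⟨ cong (λ n → ℤ.∣ + ((p + r) C (n + s)) - + 0 ∣) (ℕ.*-zeroʳ p) ⟩
    ℤ.∣ + ((p + r) C s) - + 0 ∣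
      ≡⟨ ℕ.+-identityʳ ((p + r) C s) ⟩
    (p + r) C s ∎

shifted-differences : ∀ s t m → (s + t ∸ s , s + t + m ∸ s , s + t + m ∸ (s + t) + s) ≡ (t , m + t , m + s)
shifted-differences s t m = cong₂ _,_ (ℕ.m+n∸m≡n s t) (cong₂ _,_
  (trans (cong (_∸ s) (ℕ.+-assoc s t m)) (trans (ℕ.m+n∸m≡n s (t + m)) (ℕ.+-comm t m)))
  (cong (_+ s) (ℕ.m+n∸m≡n (s + t) m)))

theorem2 : (p r s : ℕ) → Prime p → r < p → s < p →
    ((a b : ℕ) → + ((p * a + r) C (p * b + s)) ≡ + ((a C b) * (r C s)) [mod p ^ 2 ])
    ⇔ (s ≤ r
       × (+ (r C s) ≡ sign (r ∸ s) *ℤ + ((p ∸ 1 ∸ s) C (r ∸ s)) [mod p ^ 2 ])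
       × (sign (r ∸ s) *ℤ + ((p ∸ 1 ∸ s) C (r ∸ s)) ≡ sign s *ℤ + ((p ∸ 1 ∸ r + s) C s) [mod p ^ 2 ]))
theorem2 p r s p-prime r<p s<p with s ℕ.≤? r
... | no s≰r = mk⇔ (λ holds → ⊥-elim (p²∤binomial p-prime r s r<s s<p (instance-1-0 p r s r<s (holds 1 0))))
                   (λ conditions → ⊥-elim (s≰r (proj₁ conditions)))
  where
  r<s : r < s
  r<s = ℕ.≰⇒> s≰r
... | yes s≤r with ℕ.m≤n⇒∃[o]m+o≡n s≤r
...   | t , refl with ℕ.m≤n⇒∃[o]m+o≡n r<p
...     | m , refl = mk⇔
  (λ holds → ℕ.m≤m+n s t , shift (sym (shifted-differences s t m)) (Equivalence.to characterised holds))
  (λ conditions → Equivalence.from characterised (shift (shifted-differences s t m) (proj₂ conditions)))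
  where
  characterised : AllInstances (suc (s + t + m)) (s + t) s ⇔ Conditions (suc (s + t + m)) (s + t) s t (m + t) (m + s)
  characterised = characterisation p-prime s t m refl
  shift : ∀ {k k′ u u′ v v′} → (k , u , v) ≡ (k′ , u′ , v′) →
    Conditions (suc (s + t + m)) (s + t) s k u v → Conditions (suc (s + t + m)) (s + t) s k′ u′ v′
  shift = conditions-subst (suc (s + t + m)) (s + t) s
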